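{- For every integer $n\ge 0$, each of the sets $\mathcal{S}_n(1\text{ - }23,\,2\text{ - }31)$, $\mathcal{S}_n(3\text{ - }21,\,2\text{ - }13)$, $\mathcal{S}_n(12\text{ - }3,\,31\text{ - }2)$, $\mathcal{S}_n(32\text{ - }1,\,13\text{ - }2)$ has cardinality $\binom{n}{2}+1$.
   Context: A permutation of $[n]=\{1,\dots,n\}$ is written as a word $\pi=a_1a_2\cdots a_n$. For a permutation $xyz$ of $\{1,2,3\}$: $\pi$ contains the pattern $x\text{ - }yz$ if there are indices $1\le i<j<n$ such that $a_i,a_j,a_{j+1}$ are in the same relative order as $x,y,z$; $\pi$ contains the pattern $xy\text{ - }z$ if there are indices $i$ and $k$ with $i+1<k\le n$ such that $a_i,a_{i+1},a_k$ are in the same relative order as $x,y,z$. $\pi$ avoids a pattern if it does not contain it. $\mathcal{S}_n(p,q)$ is the set of permutations of $[n]$ avoiding both $p$ and $q$. Here $\binom{n}{2}=0$ for $n<2$. -}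

module Defs where

open import Data.Bool using (Bool; true; false; _∧_; _∨_; not; T)
open import Data.Nat using (ℕ; zero; suc; _<ᵇ_; _≡ᵇ_)
open import Data.Fin using (Fin; toℕ)
open import Data.List using (List; []; _∷_)
open import Data.Bool.ListAction using (any; all)
open import Data.Vec using (Vec; toList; map)
open import Data.Product using (Σ)

_==_ : Bool → Bool → Bool
true  == b = b
false == b = not b

-- A classical 3-letter pattern x y z (a permutation of {1,2,3}), given by its letters.
record Pattern3 : Set where
  constructor pat
  field
    x y z : ℕ

sameOrder : Pattern3 → ℕ → ℕ → ℕ → Bool
sameOrder (pat x y z) a b c =
  ((x <ᵇ y) == (a <ᵇ b)) ∧ ((x <ᵇ z) == (a <ᵇ c)) ∧ ((y <ᵇ z) == (b <ᵇ c))

anyAdjacent : (ℕ → ℕ → Bool) → List ℕ → Bool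
anyAdjacent f []           = false
anyAdjacent f (b ∷ [])     = false
anyAdjacent f (b ∷ c ∷ w)  = f b c ∨ anyAdjacent f (c ∷ w)

-- pattern x-yz : indices i < j < n with a_i , a_j , a_{j+1} order-isomorphic to x y z
containsDashFirst : Pattern3 → List ℕ → Bool
containsDashFirst p []      = false
containsDashFirst p (a ∷ w) =
  anyAdjacent (λ b c → sameOrder p a b c) w ∨ containsDashFirst p w

-- pattern xy-z : indices i , k with i + 1 < k with a_i , a_{i+1} , a_k order-isomorphic to x y z
containsDashLast : Pattern3 → List ℕ → Bool
containsDashLast p []          = false
containsDashLast p (a ∷ [])    = false
containsDashLast p (a ∷ b ∷ w) =
  any (λ c → sameOrder p a b c) w ∨ containsDashLast p (b ∷ w)

data DPattern : Set where
  dash-yz : Pattern3 → DPattern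
  xy-dash : Pattern3 → DPattern

contains : DPattern → List ℕ → Bool
contains (dash-yz p) w = containsDashFirst p w
contains (xy-dash p) w = containsDashLast p w

distinct : List ℕ → Bool
distinct []      = true
distinct (a ∷ w) = all (λ b → not (a ≡ᵇ b)) w ∧ distinct w

-- A word a_1 ... a_n with letters in [n] (encoded 0-based as Fin n; the shift
-- does not affect relative order) is a permutation iff its letters are distinct.
word : {n : ℕ} → Vec (Fin n) n → List ℕ
word v = toList (map toℕ v)

isPerm : {n : ℕ} → Vec (Fin n) n → Bool
isPerm v = distinct (word v)

avoids : DPattern → {n : ℕ} → Vec (Fin n) n → Bool
avoids p v = not (contains p (word v))

S : ℕ → DPattern → DPattern → Set
S n p q = Σ (Vec (Fin n) n) (λ v → T (isPerm v ∧ avoids p v ∧ avoids q v))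

p1-23 p2-31 p3-21 p2-13 p12-3 p31-2 p32-1 p13-2 : DPattern
p1-23 = dash-yz (pat 1 2 3)
p2-31 = dash-yz (pat 2 3 1)
p3-21 = dash-yz (pat 3 2 1)
p2-13 = dash-yz (pat 2 1 3)
p12-3 = xy-dash (pat 1 2 3)
p31-2 = xy-dash (pat 3 1 2)
p32-1 = xy-dash (pat 3 2 1)
p13-2 = xy-dash (pat 1 3 2)

{-# OPTIONS --safe #-}
module Submission where

-- Complementation a ↦ n − 1 − a carries the pair (1-23, 2-31) to (3-21, 2-13), and
-- reverse-complementation, which turns an occurrence of x-yz into one of (4−z)(4−y)-(4−x),
-- carries (1-23, 2-31) to (12-3, 31-2) and (3-21, 2-13) to (32-1, 13-2); so all four sets are
-- in bijection with S_n(1-23, 2-31).  A permutation avoids 1-23 and 2-31 iff, whenever a letter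
-- a is followed later by an adjacent pair b c with a < b, also a < c < b.  Hence after the first
-- letter exceeding the initial letter a the word descends and stays above a, and counting shows
-- that a permutation of {0, …, n} whose first letter a is not n must be a, a−1, …, 0, n, n−1,
-- …, a+1, while one starting with n is n followed by any member of S_n.  So
-- |S_{n+1}| = |S_n| + n, which gives C(n,2) + 1.

open import Defs
open import Data.Nat using (ℕ; _+_)
open import Data.Nat.Combinatorics using (_C_)
open import Data.Fin using (Fin)
open import Data.Product using (_×_)
open import Function.Bundles using (_↔_)

open import Data.Bool using (Bool; true; false; _∧_; _∨_; not; T)
open import Data.Bool.ListAction using (all; any)
open import Data.Bool.Properties using (T-∧; T-∨; T-irrelevant; not-involutive; ∧-assoc; ∧-comm)
open import Data.Empty using (⊥-elim)
open import Data.Fin using (toℕ; fromℕ<; zero)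
open import Data.Fin.Properties using (toℕ<n; toℕ-fromℕ<; fromℕ<-toℕ; +↔⊎)
open import Data.List using (List; []; _∷_; _++_; length; map; reverse; applyDownFrom)
open import Data.List.Membership.Propositional using (find)
open import Data.List.Membership.Propositional.Properties using (∈-∃++)
open import Data.List.Properties
  using (++-assoc; length-++; length-map; length-reverse; length-applyDownFrom; map-++;
         reverse-++; reverse-map; reverse-involutive; unfold-reverse)
open import Data.List.Relation.Binary.Permutation.Propositional using (_↭_; ↭-sym; ↭⇒↭ₛ)
open import Data.List.Relation.Binary.Permutation.Propositional.Properties
  using (All-resp-↭; ↭-length; ↭-reverse; shift)
import Data.List.Relation.Binary.Permutation.Setoid.Properties as ↭ₛ
open import Data.List.Relation.Unary.All as All using (All; []; _∷_)
open import Data.List.Relation.Unary.All.Properties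
  using (¬Any⇒All¬; all⁺; all⁻; map⁺; ++⁻ʳ; applyDownFrom⁺₁) renaming (++⁺ to All-++⁺)
import Data.List.Relation.Unary.AllPairs as AllPairs
open import Data.List.Relation.Unary.AllPairs using ([]; _∷_)
open import Data.List.Relation.Unary.Any as Any using (Any; here; there; any?)
open import Data.List.Relation.Unary.Any.Properties using (any⁺; any⁻; ++⁺ʳ; ++⁻)
open import Data.List.Relation.Unary.Linked as Linked using (Linked; []; [-]; _∷_)
open import Data.List.Relation.Unary.Linked.Properties
  using (Linked⇒All; Linked⇒AllPairs; AllPairs⇒Linked) renaming (applyDownFrom⁺₂ to Linked-applyDownFrom⁺₂)
open import Data.List.Relation.Unary.Unique.Propositional using (Unique)
open import Data.List.Relation.Unary.Unique.Propositional.Properties using (map⁻) renaming (++⁺ to Unique-++⁺)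
open import Data.Nat using (zero; suc; _∸_; _<ᵇ_; _≡ᵇ_; _≤_; _<_; _>_; z≤n; s≤s; _≟_; _<?_; _≤?_)
open import Data.Nat.Combinatorics using (nC1≡n; nCk+nC[k+1]≡[n+1]C[k+1])
open import Data.Nat.Properties
open import Data.List.Relation.Unary.Unique.DecPropositional _≟_ using (unique?)
open import Data.Product using (Σ; ∃₂; _,_; proj₁; proj₂)
open import Data.Sum using (_⊎_; inj₁; inj₂; [_,_]′)
open import Data.Sum.Function.Propositional using (_⊎-↔_)
open import Data.Unit using (⊤)
open import Data.Vec as Vec using (Vec; toList)
open import Function using (_∘′_)
open import Function.Bundles using (_⇔_; mk⇔; Equivalence; mk↔ₛ′)
open import Function.Properties.Inverse using (↔-refl; ↔-sym; ↔-trans)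
open import Relation.Binary using (tri<; tri≈; tri>)
open import Relation.Binary.PropositionalEquality
open import Relation.Nullary using (¬_; yes; no)
open import Relation.Nullary.Decidable using (from-yes; From-yes)

private
  variable
    a b c k m n x y : ℕ
    s t : Bool
    w σ τ : List ℕ

T-extensional : (T s → T t) → (T t → T s) → s ≡ t
T-extensional {false} {false} _ _ = refl
T-extensional {false} {true}  _ g = ⊥-elim (g _)
T-extensional {true}  {false} f _ = ⊥-elim (f _)
T-extensional {true}  {true}  _ _ = refl

T-not⇔¬T : T (not s) ⇔ (¬ T s)
T-not⇔¬T {false} = mk⇔ (λ _ ()) (λ _ → _)
T-not⇔¬T {true}  = mk⇔ (λ ()) (λ ¬t → ¬t _)

¬T-∨ : (¬ T (s ∨ t)) ⇔ (¬ T s × ¬ T t)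
¬T-∨ {false} = mk⇔ (λ ¬t → (λ ()) , ¬t) proj₂
¬T-∨ {true}  = mk⇔ (λ ¬t → ⊥-elim (¬t _)) (λ (¬s , _) _ → ¬s _)

T-∨-elim : ∀ s → T (s ∨ t) → T s ⊎ T t
T-∨-elim true  _  = inj₁ _
T-∨-elim false ts = inj₂ ts

T-∨-introˡ : ∀ t → T s → T (s ∨ t)
T-∨-introˡ _ ts = Equivalence.from T-∨ (inj₁ ts)

T-∨-introʳ : ∀ s → T t → T (s ∨ t)
T-∨-introʳ _ tt′ = Equivalence.from T-∨ (inj₂ tt′)

T-∧-intro : T s → T t → T (s ∧ t)
T-∧-intro ts tt′ = Equivalence.from T-∧ (ts , tt′)

T-not-≡ᵇ⇔≢ : T (not (a ≡ᵇ b)) ⇔ (a ≢ b)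
T-not-≡ᵇ⇔≢ {a} {b} = mk⇔
  (λ t a≡b → Equivalence.to T-not⇔¬T t (≡⇒≡ᵇ a b a≡b))
  (λ a≢b → Equivalence.from T-not⇔¬T (a≢b ∘′ ≡ᵇ⇒≡ a b))

<ᵇ-flip : x ≢ y → (y <ᵇ x) ≡ not (x <ᵇ y)
<ᵇ-flip {x} {y} x≢y = T-extensional
  (λ y<x → Equivalence.from T-not⇔¬T (λ x<y → <-asym (<ᵇ⇒< x y x<y) (<ᵇ⇒< y x y<x)))
  (λ x≮y → <⇒<ᵇ (≤∧≢⇒< (≮⇒≥ (Equivalence.to T-not⇔¬T x≮y ∘′ <⇒<ᵇ)) (x≢y ∘′ sym)))

∸-<ᵇ-flip : x ≤ k → (k ∸ x <ᵇ k ∸ y) ≡ (y <ᵇ x)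
∸-<ᵇ-flip {x} {k} {y} x≤k = T-extensional
  (λ lt → <⇒<ᵇ (∸-cancelʳ-< {x} {y} {k} (<ᵇ⇒< (k ∸ x) (k ∸ y) lt)))
  (λ y<x → <⇒<ᵇ (∸-monoʳ-< (<ᵇ⇒< y x y<x) x≤k))

not-==-not : ∀ s t → (not s == not t) ≡ (s == t)
not-==-not false t = refl
not-==-not true  t = not-involutive t

<ᵇ-==-flip : x ≢ y → a ≢ b → ((y <ᵇ x) == (b <ᵇ a)) ≡ ((x <ᵇ y) == (a <ᵇ b))
<ᵇ-==-flip {x} {y} {a} {b} x≢y a≢b =
  trans (cong₂ _==_ (<ᵇ-flip x≢y) (<ᵇ-flip a≢b)) (not-==-not (x <ᵇ y) (a <ᵇ b))

≤-+-≡⇒≡ : x ≤ a → y ≤ b → x + y ≡ a + b → x ≡ a × y ≡ b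
≤-+-≡⇒≡ {x} {a} {y} {b} x≤a y≤b eq with m≤n⇒m<n∨m≡n x≤a
... | inj₁ x<a  = ⊥-elim (<-irrefl eq (+-mono-<-≤ x<a y≤b))
... | inj₂ refl = refl , +-cancelˡ-≡ x y b eq

Σ-T-≡ : {A : Set} {P : A → Bool} {u v : A} {pu : T (P u)} {pv : T (P v)} →
        u ≡ v → _≡_ {A = Σ A (λ u → T (P u))} (u , pu) (v , pv)
Σ-T-≡ refl = cong (_ ,_) (T-irrelevant _ _)

All<1+n∧≢n⇒<n : All (_< suc n) w → All (n ≢_) w → All (_< n) w
All<1+n∧≢n⇒<n w<1+n n∉w = All.zipWith (λ (x<1+n , n≢x) → ≤∧≢⇒< (≤-pred x<1+n) (n≢x ∘′ sym)) (w<1+n , n∉w)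

Unique-resp-↭ : {xs ys : List ℕ} → xs ↭ ys → Unique xs → Unique ys
Unique-resp-↭ π = ↭ₛ.Unique-resp-↭ (setoid ℕ) (↭⇒↭ₛ π)

unique-bounded⇒length≤ : ∀ n {xs} → Unique xs → All (_< n) xs → length xs ≤ n
unique-bounded⇒length≤ zero    {[]}    _ _         = z≤n
unique-bounded⇒length≤ zero    {_ ∷ _} _ (() ∷ _)
unique-bounded⇒length≤ (suc n) {xs}    u xs<1+n with any? (n ≟_) xs
... | no n∉xs = m≤n⇒m≤1+n (unique-bounded⇒length≤ n u (All<1+n∧≢n⇒<n xs<1+n (¬Any⇒All¬ xs n∉xs)))
... | yes n∈xs with ys , zs , refl ← ∈-∃++ n∈xs
    with n∉ys++zs ∷ u′ ← Unique-resp-↭ (shift n ys zs) u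
    with _ ∷ ys++zs<1+n ← All-resp-↭ (shift n ys zs) xs<1+n = begin
  length (ys ++ n ∷ zs)   ≡⟨ ↭-length (shift n ys zs) ⟩
  suc (length (ys ++ zs)) ≤⟨ s≤s (unique-bounded⇒length≤ n u′ (All<1+n∧≢n⇒<n ys++zs<1+n n∉ys++zs)) ⟩
  suc n                   ∎
  where open ≤-Reasoning

unique⇒exists-above : Unique w → suc a < length w → Any (a <_) w
unique⇒exists-above {w} {a} u 1+a<|w| with any? (a <?_) w
... | yes a<w  = a<w
... | no  ¬a<w = ⊥-elim (<⇒≱ 1+a<|w| (unique-bounded⇒length≤ (suc a) u
                   (All.map (λ a≮x → s≤s (≮⇒≥ a≮x)) (¬Any⇒All¬ w ¬a<w))))

Unique-reverse : Unique w → Unique (reverse w)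
Unique-reverse {w} = Unique-resp-↭ (↭-sym (↭-reverse w))

All-reverse : {P : ℕ → Set} → All P w → All P (reverse w)
All-reverse {w} = All-resp-↭ (↭-sym (↭-reverse w))

reverse-++-∷ : ∀ (xs : List ℕ) x ys → reverse (xs ++ x ∷ ys) ≡ reverse ys ++ x ∷ reverse xs
reverse-++-∷ xs x ys = begin
  reverse (xs ++ x ∷ ys)               ≡⟨ reverse-++ xs (x ∷ ys) ⟩
  reverse (x ∷ ys) ++ reverse xs       ≡⟨ cong (_++ reverse xs) (unfold-reverse x ys) ⟩
  (reverse ys ++ x ∷ []) ++ reverse xs ≡⟨ ++-assoc (reverse ys) (x ∷ []) (reverse xs) ⟩
  reverse ys ++ x ∷ reverse xs         ∎
  where open ≡-Reasoning

Linked-++⁻ʳ : ∀ {R : ℕ → ℕ → Set} σ → Linked R (σ ++ τ) → Linked R τ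
Linked-++⁻ʳ []      l = l
Linked-++⁻ʳ (_ ∷ σ) l = Linked-++⁻ʳ σ (Linked.tail l)

-- Descending runs

>-trans : a > b → b > c → a > c
>-trans a>b b>c = <-trans b>c a>b

descending⇒below : Linked _>_ (x ∷ w) → All (_< x) w
descending⇒below [-]       = []
descending⇒below (x>y ∷ d) = Linked⇒All >-trans x>y d

below∷descending : All (_< x) w → Linked _>_ w → Linked _>_ (x ∷ w)
below∷descending []        [] = [-]
below∷descending (y<x ∷ _) d  = y<x ∷ d

descending⇒Unique : Linked _>_ w → Unique w
descending⇒Unique d = AllPairs.map >⇒≢ (Linked⇒AllPairs >-trans d)

run : ℕ → ℕ → List ℕ
run lo d = applyDownFrom (lo +_) d

run-descending : ∀ lo d → Linked _>_ (run lo d)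
run-descending lo d = Linked-applyDownFrom⁺₂ (lo +_) d (λ i → +-monoʳ-< lo (n<1+n i))

run-bounded : ∀ lo d → All (λ x → lo ≤ x × x < lo + d) (run lo d)
run-bounded lo d = applyDownFrom⁺₁ (lo +_) d (λ i<d → m≤m+n lo _ , +-monoʳ-< lo i<d)

descending-length≤ : ∀ lo d → Linked _>_ (lo + d ∷ σ) → All (lo ≤_) σ → length σ ≤ d
descending-length≤ {σ = []}    lo d _          _             = z≤n
descending-length≤ {σ = x ∷ σ} lo d (x<h ∷ dσ) (lo≤x ∷ lo≤σ) with e , refl ← m≤n⇒∃[o]m+o≡n lo≤x =
  ≤-trans (s≤s (descending-length≤ lo e dσ lo≤σ)) (+-cancelˡ-< lo e d x<h)

descending-full⇒run : ∀ lo d → Linked _>_ (lo + d ∷ σ) → All (lo ≤_) σ → length σ ≡ d → σ ≡ run lo d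
descending-full⇒run {σ = []}    lo zero    _          _             _   = refl
descending-full⇒run {σ = x ∷ σ} lo (suc d) (x<h ∷ dσ) (lo≤x ∷ lo≤σ) len
  with e , refl ← m≤n⇒∃[o]m+o≡n lo≤x
  with refl ← ≤-antisym (≤-pred (+-cancelˡ-< lo e (suc d) x<h))
                        (subst (_≤ e) (suc-injective len) (descending-length≤ lo e dσ lo≤σ)) =
  cong (lo + e ∷_) (descending-full⇒run lo e dσ lo≤σ (suc-injective len))

-- Permutations as words of naturals

toWord : Vec (Fin n) m → List ℕ
toWord v = toList (Vec.map toℕ v)

fromWord : ∀ m w → length w ≡ m → All (_< n) w → Vec (Fin n) m
fromWord zero    []      _  _           = Vec.[]
fromWord (suc m) (x ∷ w) eq (x<n ∷ w<n) = fromℕ< x<n Vec.∷ fromWord m w (suc-injective eq) w<n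

toWord-fromWord : ∀ m w (eq : length w ≡ m) (w<n : All (_< n) w) → toWord (fromWord m w eq w<n) ≡ w
toWord-fromWord zero    []      _  _           = refl
toWord-fromWord (suc m) (x ∷ w) eq (x<n ∷ w<n) = cong₂ _∷_ (toℕ-fromℕ< x<n) (toWord-fromWord m w _ w<n)

fromWord-toWord : (v : Vec (Fin n) m) → ∀ eq v<n → fromWord m (toWord v) eq v<n ≡ v
fromWord-toWord Vec.[]      _ _           = refl
fromWord-toWord (i Vec.∷ v) _ (i<n ∷ v<n) = cong₂ Vec._∷_ (fromℕ<-toℕ i i<n) (fromWord-toWord v _ v<n)

length-toWord : (v : Vec (Fin n) m) → length (toWord v) ≡ m
length-toWord Vec.[]      = refl
length-toWord (_ Vec.∷ v) = cong suc (length-toWord v)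

toWord-bounded : (v : Vec (Fin n) m) → All (_< n) (toWord v)
toWord-bounded Vec.[]      = []
toWord-bounded (i Vec.∷ v) = toℕ<n i ∷ toWord-bounded v

isWordᵇ : ℕ → ℕ → List ℕ → Bool
isWordᵇ n m w = (length w ≡ᵇ m) ∧ all (_<ᵇ n) w

T-isWordᵇ : T (isWordᵇ n m w) ⇔ (length w ≡ m × All (_< n) w)
T-isWordᵇ {n} {m} {w} = mk⇔
  (λ t → let (eq , w<n) = Equivalence.to T-∧ t
         in ≡ᵇ⇒≡ _ _ eq , All.map (<ᵇ⇒< _ n) (all⁺ (_<ᵇ n) w w<n))
  (λ (eq , w<n) → T-∧-intro (≡⇒≡ᵇ _ _ eq) (all⁻ (_<ᵇ n) (All.map <⇒<ᵇ w<n)))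

Vec↔List : (Q : List ℕ → Bool) →
           Σ (Vec (Fin n) m) (λ v → T (Q (toWord v))) ↔ Σ (List ℕ) (λ w → T (isWordᵇ n m w ∧ Q w))
Vec↔List {n} {m} Q = mk↔ₛ′ to from to∘from from∘to
  where
  to : Σ (Vec (Fin n) m) (λ v → T (Q (toWord v))) → Σ (List ℕ) (λ w → T (isWordᵇ n m w ∧ Q w))
  to (v , qv) = toWord v , T-∧-intro (Equivalence.from T-isWordᵇ (length-toWord v , toWord-bounded v)) qv
  from : Σ (List ℕ) (λ w → T (isWordᵇ n m w ∧ Q w)) → Σ (Vec (Fin n) m) (λ v → T (Q (toWord v)))
  from (w , t) = let (isw , qw) = Equivalence.to T-∧ t ; (eq , w<n) = Equivalence.to T-isWordᵇ isw
    in fromWord m w eq w<n , subst (T ∘′ Q) (sym (toWord-fromWord m w eq w<n)) qw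
  to∘from : ∀ x → to (from x) ≡ x
  to∘from (w , _) = Σ-T-≡ (toWord-fromWord m w _ _)
  from∘to : ∀ x → from (to x) ≡ x
  from∘to (v , _) = Σ-T-≡ (fromWord-toWord v _ _)

T-distinct⇔Unique : T (distinct w) ⇔ Unique w
T-distinct⇔Unique {[]}    = mk⇔ (λ _ → []) (λ _ → _)
T-distinct⇔Unique {a ∷ w} = mk⇔
  (λ t → let (a∉w , d) = Equivalence.to T-∧ t
         in All.map (Equivalence.to T-not-≡ᵇ⇔≢) (all⁺ _ w a∉w) ∷ Equivalence.to T-distinct⇔Unique d)
  (λ { (a∉w ∷ u) → T-∧-intro (all⁻ _ (All.map (Equivalence.from T-not-≡ᵇ⇔≢) a∉w))
                             (Equivalence.from T-distinct⇔Unique u) })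

record IsPermutation (n : ℕ) (w : List ℕ) : Set where
  field
    length≡ : length w ≡ n
    bounded : All (_< n) w
    unique  : Unique w

open IsPermutation

permutationAvoidingᵇ : DPattern → DPattern → List ℕ → Bool
permutationAvoidingᵇ p q w = distinct w ∧ not (contains p w) ∧ not (contains q w)

-- S n p q on plain words; membership stays a Boolean test, so that membership proofs are
-- irrelevant and two members are equal as soon as their words are.
Avoiders : ℕ → DPattern → DPattern → Set
Avoiders n p q = Σ (List ℕ) (λ w → T (isWordᵇ n n w ∧ permutationAvoidingᵇ p q w))

S↔Avoiders : ∀ p q → S n p q ↔ Avoiders n p q
S↔Avoiders p q = Vec↔List (permutationAvoidingᵇ p q)

record Avoider (n : ℕ) (p q : DPattern) (w : List ℕ) : Set where
  constructor avoider
  field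
    isPermutation : IsPermutation n w
    avoids-p      : ¬ T (contains p w)
    avoids-q      : ¬ T (contains q w)

open Avoider

T-Avoider : ∀ p q → T (isWordᵇ n n w ∧ permutationAvoidingᵇ p q w) ⇔ Avoider n p q w
T-Avoider p q = mk⇔
  (λ t → let (isw , t′)  = Equivalence.to T-∧ t ; (d , t″) = Equivalence.to T-∧ t′
             (¬p , ¬q) = Equivalence.to T-∧ t″ ; (len , w<n) = Equivalence.to T-isWordᵇ isw
         in avoider (record { length≡ = len ; bounded = w<n ; unique = Equivalence.to T-distinct⇔Unique d })
                    (Equivalence.to T-not⇔¬T ¬p) (Equivalence.to T-not⇔¬T ¬q))
  (λ (avoider π ¬p ¬q) → T-∧-intro (Equivalence.from T-isWordᵇ (length≡ π , bounded π))
    (T-∧-intro (Equivalence.from T-distinct⇔Unique (unique π))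
      (T-∧-intro (Equivalence.from T-not⇔¬T ¬p) (Equivalence.from T-not⇔¬T ¬q))))

involution⇒Avoiders-↔ : ∀ p q p′ q′ (f : List ℕ → List ℕ) →
  (∀ {w} → IsPermutation n w → IsPermutation n (f w)) →
  (∀ {w} → All (_< n) w → f (f w) ≡ w) →
  (∀ {w} → IsPermutation n w → contains p′ (f w) ≡ contains p w) →
  (∀ {w} → IsPermutation n w → contains q′ (f w) ≡ contains q w) →
  Avoiders n p q ↔ Avoiders n p′ q′
involution⇒Avoiders-↔ {n} p q p′ q′ f f-perm f-involutive p′∘f≡p q′∘f≡q = mk↔ₛ′ to from to∘from from∘to
  where
  undo : ∀ {r r′ w} → (∀ {w} → IsPermutation n w → contains r′ (f w) ≡ contains r w) →
         IsPermutation n w → contains r (f w) ≡ contains r′ w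
  undo {r′ = r′} r′∘f≡r π = trans (sym (r′∘f≡r (f-perm π))) (cong (contains r′) (f-involutive (bounded π)))
  forth : ∀ {w} → Avoider n p q w → Avoider n p′ q′ (f w)
  forth (avoider π ¬p ¬q) = avoider (f-perm π) (¬p ∘′ subst T (p′∘f≡p π)) (¬q ∘′ subst T (q′∘f≡q π))
  back : ∀ {w} → Avoider n p′ q′ w → Avoider n p q (f w)
  back (avoider π ¬p′ ¬q′) =
    avoider (f-perm π) (¬p′ ∘′ subst T (undo {p} {p′} p′∘f≡p π)) (¬q′ ∘′ subst T (undo {q} {q′} q′∘f≡q π))
  to : Avoiders n p q → Avoiders n p′ q′
  to (w , t) = f w , Equivalence.from (T-Avoider p′ q′) (forth (Equivalence.to (T-Avoider p q) t))
  from : Avoiders n p′ q′ → Avoiders n p q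
  from (w , t) = f w , Equivalence.from (T-Avoider p q) (back (Equivalence.to (T-Avoider p′ q′) t))
  to∘from : ∀ x → to (from x) ≡ x
  to∘from (w , t) = Σ-T-≡ (f-involutive (bounded (isPermutation (Equivalence.to (T-Avoider p′ q′) t))))
  from∘to : ∀ x → from (to x) ≡ x
  from∘to (w , t) = Σ-T-≡ (f-involutive (bounded (isPermutation (Equivalence.to (T-Avoider p q) t))))

-- Complement

lettersᴾ : Pattern3 → List ℕ
lettersᴾ (pat x y z) = x ∷ y ∷ z ∷ []

-- On letters in {0, …, 4}, and so on the letters 1, 2, 3 of a classical pattern, 4 ∸_ reverses
-- the order.
complementᴾ : Pattern3 → Pattern3
complementᴾ (pat x y z) = pat (4 ∸ x) (4 ∸ y) (4 ∸ z)

complement : ℕ → List ℕ → List ℕ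
complement n = map (λ a → n ∸ suc a)

∸-suc-< : a < n → n ∸ suc a < n
∸-suc-< {a} {suc n} _ = s≤s (m∸n≤m n a)

∸-suc-involutive : a < n → n ∸ suc (n ∸ suc a) ≡ a
∸-suc-involutive {n = suc n} (s≤s a≤n) = m∸[m∸n]≡n a≤n

complement-involutive : All (_< n) w → complement n (complement n w) ≡ w
complement-involutive []          = refl
complement-involutive (a<n ∷ w<n) = cong₂ _∷_ (∸-suc-involutive a<n) (complement-involutive w<n)

IsPermutation-complement : IsPermutation n w → IsPermutation n (complement n w)
IsPermutation-complement {w = w} π = record
  { length≡ = trans (length-map _ w) (length≡ π)
  ; bounded = map⁺ (All.map ∸-suc-< (bounded π))
  ; unique  = map⁻ (subst Unique (sym (complement-involutive (bounded π))) (unique π))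
  }

sameOrder-complement : ∀ p → Unique (lettersᴾ p) → All (_≤ 4) (lettersᴾ p) →
  All (_< n) (a ∷ b ∷ c ∷ []) → Unique (a ∷ b ∷ c ∷ []) →
  sameOrder (complementᴾ p) (n ∸ suc a) (n ∸ suc b) (n ∸ suc c) ≡ sameOrder p a b c
sameOrder-complement {n} (pat x y z) ((x≢y ∷ x≢z ∷ []) ∷ (y≢z ∷ []) ∷ [] ∷ []) (x≤4 ∷ y≤4 ∷ _ ∷ [])
  (a<n ∷ b<n ∷ _ ∷ []) ((a≢b ∷ a≢c ∷ []) ∷ (b≢c ∷ []) ∷ [] ∷ []) =
  cong₂ _∧_ (flip x≤4 a<n x≢y a≢b) (cong₂ _∧_ (flip x≤4 a<n x≢z a≢c) (flip y≤4 b<n y≢z b≢c))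
  where
  flip : ∀ {u v d e} → u ≤ 4 → d < n → u ≢ v → d ≢ e →
         ((4 ∸ u <ᵇ 4 ∸ v) == (n ∸ suc d <ᵇ n ∸ suc e)) ≡ ((u <ᵇ v) == (d <ᵇ e))
  flip {v = v} {e = e} u≤4 d<n u≢v d≢e =
    trans (cong₂ _==_ (∸-<ᵇ-flip {y = v} u≤4) (∸-<ᵇ-flip {y = suc e} d<n)) (<ᵇ-==-flip u≢v d≢e)

anyAdjacent-map : {P : ℕ → Set} {f h : ℕ → ℕ → Bool} (g : ℕ → ℕ) →
  (∀ {b c} → P b → P c → b ≢ c → f (g b) (g c) ≡ h b c) →
  All P w → Unique w → anyAdjacent f (map g w) ≡ anyAdjacent h w
anyAdjacent-map g f≗h []             _               = refl
anyAdjacent-map g f≗h (_ ∷ [])       _               = refl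
anyAdjacent-map g f≗h (Pb ∷ Pc ∷ Pw) ((b≢c ∷ _) ∷ u) =
  cong₂ _∨_ (f≗h Pb Pc b≢c) (anyAdjacent-map g f≗h (Pc ∷ Pw) u)

containsDashFirst-map : {P : ℕ → Set} {p p′ : Pattern3} (g : ℕ → ℕ) →
  (∀ {a b c} → All P (a ∷ b ∷ c ∷ []) → Unique (a ∷ b ∷ c ∷ []) →
     sameOrder p′ (g a) (g b) (g c) ≡ sameOrder p a b c) →
  All P w → Unique w → containsDashFirst p′ (map g w) ≡ containsDashFirst p w
containsDashFirst-map g p′≗p []        _         = refl
containsDashFirst-map g p′≗p (Pa ∷ Pw) (a∉w ∷ u) = cong₂ _∨_
  (anyAdjacent-map g (λ (Pb , a≢b) (Pc , a≢c) b≢c →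
     p′≗p (Pa ∷ Pb ∷ Pc ∷ []) ((a≢b ∷ a≢c ∷ []) ∷ (b≢c ∷ []) ∷ [] ∷ [])) (All.zip (Pw , a∉w)) u)
  (containsDashFirst-map g p′≗p Pw u)

contains-complement : ∀ p → Unique (lettersᴾ p) → All (_≤ 4) (lettersᴾ p) → IsPermutation n w →
  contains (dash-yz (complementᴾ p)) (complement n w) ≡ contains (dash-yz p) w
contains-complement {n} p p-unique p≤4 π =
  containsDashFirst-map (λ a → n ∸ suc a) (sameOrder-complement p p-unique p≤4) (bounded π) (unique π)

complement-↔ : ∀ p q → Unique (lettersᴾ p) → All (_≤ 4) (lettersᴾ p) →
                       Unique (lettersᴾ q) → All (_≤ 4) (lettersᴾ q) →
  Avoiders n (dash-yz p) (dash-yz q) ↔ Avoiders n (dash-yz (complementᴾ p)) (dash-yz (complementᴾ q))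
complement-↔ {n} p q p-unique p≤4 q-unique q≤4 =
  involution⇒Avoiders-↔ (dash-yz p) (dash-yz q) (dash-yz (complementᴾ p)) (dash-yz (complementᴾ q))
    (complement n) IsPermutation-complement complement-involutive
    (contains-complement p p-unique p≤4) (contains-complement q q-unique q≤4)

-- Reverse-complement

lettersᴰ : DPattern → List ℕ
lettersᴰ (dash-yz p) = lettersᴾ p
lettersᴰ (xy-dash p) = lettersᴾ p

reverseComplementᴾ : Pattern3 → Pattern3
reverseComplementᴾ (pat x y z) = pat (4 ∸ z) (4 ∸ y) (4 ∸ x)

reverseComplementᴰ : DPattern → DPattern
reverseComplementᴰ (dash-yz p) = xy-dash (reverseComplementᴾ p)
reverseComplementᴰ (xy-dash p) = dash-yz (reverseComplementᴾ p)

reverseComplementᴾ-involutive : ∀ p → All (_≤ 4) (lettersᴾ p) → reverseComplementᴾ (reverseComplementᴾ p) ≡ p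
reverseComplementᴾ-involutive (pat x y z) (x≤4 ∷ y≤4 ∷ z≤4 ∷ [])
  rewrite m∸[m∸n]≡n x≤4 | m∸[m∸n]≡n y≤4 | m∸[m∸n]≡n z≤4 = refl

reverseComplementᴰ-involutive : ∀ p → All (_≤ 4) (lettersᴰ p) → reverseComplementᴰ (reverseComplementᴰ p) ≡ p
reverseComplementᴰ-involutive (dash-yz p) p≤4 = cong dash-yz (reverseComplementᴾ-involutive p p≤4)
reverseComplementᴰ-involutive (xy-dash p) p≤4 = cong xy-dash (reverseComplementᴾ-involutive p p≤4)

reverseComplementᴰ-≤4 : ∀ p → All (_≤ 4) (lettersᴰ (reverseComplementᴰ p))
reverseComplementᴰ-≤4 (dash-yz (pat x y z)) = m∸n≤m 4 z ∷ m∸n≤m 4 y ∷ m∸n≤m 4 x ∷ []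
reverseComplementᴰ-≤4 (xy-dash (pat x y z)) = m∸n≤m 4 z ∷ m∸n≤m 4 y ∷ m∸n≤m 4 x ∷ []

sameOrder-reverseComplement : ∀ p → All (_≤ 4) (lettersᴾ p) → All (_< n) (a ∷ b ∷ c ∷ []) →
  sameOrder (reverseComplementᴾ p) (n ∸ suc c) (n ∸ suc b) (n ∸ suc a) ≡ sameOrder p a b c
sameOrder-reverseComplement {n} {a} {b} {c} (pat x y z) (_ ∷ y≤4 ∷ z≤4 ∷ []) (_ ∷ b<n ∷ c<n ∷ []) = begin
  ((4 ∸ z <ᵇ 4 ∸ y) == (n ∸ suc c <ᵇ n ∸ suc b)) ∧ ((4 ∸ z <ᵇ 4 ∸ x) == (n ∸ suc c <ᵇ n ∸ suc a)) ∧
    ((4 ∸ y <ᵇ 4 ∸ x) == (n ∸ suc b <ᵇ n ∸ suc a))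
                ≡⟨ cong₂ _∧_ (flip z≤4 c<n) (cong₂ _∧_ (flip z≤4 c<n) (flip y≤4 b<n)) ⟩
  Z ∧ Y ∧ X     ≡⟨ ∧-assoc Z Y X ⟨
  (Z ∧ Y) ∧ X   ≡⟨ ∧-comm (Z ∧ Y) X ⟩
  X ∧ Z ∧ Y     ≡⟨ cong (X ∧_) (∧-comm Z Y) ⟩
  X ∧ Y ∧ Z     ∎
  where
  open ≡-Reasoning
  X = (x <ᵇ y) == (a <ᵇ b)
  Y = (x <ᵇ z) == (a <ᵇ c)
  Z = (y <ᵇ z) == (b <ᵇ c)
  flip : ∀ {u v d e} → u ≤ 4 → d < n → ((4 ∸ u <ᵇ 4 ∸ v) == (n ∸ suc d <ᵇ n ∸ suc e)) ≡ ((v <ᵇ u) == (e <ᵇ d))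
  flip {v = v} {e = e} u≤4 d<n = cong₂ _==_ (∸-<ᵇ-flip {y = v} u≤4) (∸-<ᵇ-flip {y = suc e} d<n)

reverseComplement : ℕ → List ℕ → List ℕ
reverseComplement n w = reverse (complement n w)

reverseComplement-involutive : All (_< n) w → reverseComplement n (reverseComplement n w) ≡ w
reverseComplement-involutive {n} {w} w<n = begin
  reverse (complement n (reverse (complement n w))) ≡⟨ cong reverse (reverse-map _ (complement n w)) ⟩
  reverse (reverse (complement n (complement n w))) ≡⟨ reverse-involutive _ ⟩
  complement n (complement n w)                     ≡⟨ complement-involutive w<n ⟩
  w                                                 ∎
  where open ≡-Reasoning

IsPermutation-reverseComplement : IsPermutation n w → IsPermutation n (reverseComplement n w)
IsPermutation-reverseComplement {n} {w} π = record
  { length≡ = trans (length-reverse (complement n w)) (length≡ π′)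
  ; bounded = All-reverse (bounded π′)
  ; unique  = Unique-reverse (unique π′)
  }
  where π′ = IsPermutation-complement π

reverseComplement-++-∷ : ∀ n xs x ys →
  reverseComplement n (xs ++ x ∷ ys) ≡ reverseComplement n ys ++ n ∸ suc x ∷ reverseComplement n xs
reverseComplement-++-∷ n xs x ys =
  trans (cong reverse (map-++ _ xs (x ∷ ys))) (reverse-++-∷ (complement n xs) (n ∸ suc x) (complement n ys))

data Occurrence : DPattern → List ℕ → Set where
  dash-yz : ∀ {p} u a v b c t → T (sameOrder p a b c) → Occurrence (dash-yz p) (u ++ a ∷ v ++ b ∷ c ∷ t)
  xy-dash : ∀ {p} u a b v c t → T (sameOrder p a b c) → Occurrence (xy-dash p) (u ++ a ∷ b ∷ v ++ c ∷ t)

Occurrence-∷ : ∀ {p} → Occurrence p w → Occurrence p (x ∷ w)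
Occurrence-∷ (dash-yz u a v b c t o) = dash-yz (_ ∷ u) a v b c t o
Occurrence-∷ (xy-dash u a b v c t o) = xy-dash (_ ∷ u) a b v c t o

data AdjacentPair (f : ℕ → ℕ → Bool) : List ℕ → Set where
  adjacentPair : ∀ v b c t → T (f b c) → AdjacentPair f (v ++ b ∷ c ∷ t)

AdjacentPair-∷ : ∀ {f} → AdjacentPair f w → AdjacentPair f (x ∷ w)
AdjacentPair-∷ (adjacentPair v b c t o) = adjacentPair (_ ∷ v) b c t o

anyAdjacent⇒AdjacentPair : ∀ f w → T (anyAdjacent f w) → AdjacentPair f w
anyAdjacent⇒AdjacentPair f (b ∷ c ∷ w) h =
  [ adjacentPair [] b c w , AdjacentPair-∷ ∘′ anyAdjacent⇒AdjacentPair f (c ∷ w) ]′ (T-∨-elim (f b c) h)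

anyAdjacent-++ : ∀ f v → T (f b c) → T (anyAdjacent f (v ++ b ∷ c ∷ w))
anyAdjacent-++ {c = c} {w}     f []          fbc = T-∨-introˡ (anyAdjacent f (c ∷ w)) fbc
anyAdjacent-++ {b = b} {w = w} f (x ∷ [])    fbc = T-∨-introʳ (f x b) (anyAdjacent-++ {w = w} f [] fbc)
anyAdjacent-++ {w = w}         f (x ∷ y ∷ v) fbc = T-∨-introʳ (f x y) (anyAdjacent-++ {w = w} f (y ∷ v) fbc)

AdjacentPair⇒Occurrence : ∀ {p} → AdjacentPair (sameOrder p a) w → Occurrence (dash-yz p) (a ∷ w)
AdjacentPair⇒Occurrence (adjacentPair v b c t o) = dash-yz [] _ v b c t o

Any⇒Occurrence : ∀ {p} → Any (T ∘′ sameOrder p a b) w → Occurrence (xy-dash p) (a ∷ b ∷ w)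
Any⇒Occurrence later with c , c∈w , o ← find later with v , t , refl ← ∈-∃++ c∈w = xy-dash [] _ _ v c t o

contains⇒Occurrence : ∀ p w → T (contains p w) → Occurrence p w
contains⇒Occurrence (dash-yz p) (a ∷ w) h =
  [ AdjacentPair⇒Occurrence ∘′ anyAdjacent⇒AdjacentPair (sameOrder p a) w
  , Occurrence-∷ ∘′ contains⇒Occurrence (dash-yz p) w
  ]′ (T-∨-elim (anyAdjacent (sameOrder p a) w) h)
contains⇒Occurrence (xy-dash p) (a ∷ b ∷ w) h =
  [ Any⇒Occurrence ∘′ any⁻ (sameOrder p a b) w
  , Occurrence-∷ ∘′ contains⇒Occurrence (xy-dash p) (b ∷ w)
  ]′ (T-∨-elim (any (sameOrder p a b) w) h)

Occurrence⇒contains : ∀ {p} → Occurrence p w → T (contains p w)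
Occurrence⇒contains {p = dash-yz p} (dash-yz [] a v b c t o) =
  T-∨-introˡ (containsDashFirst p (v ++ b ∷ c ∷ t)) (anyAdjacent-++ (sameOrder p a) v o)
Occurrence⇒contains {p = dash-yz p} (dash-yz (x ∷ u) a v b c t o) =
  T-∨-introʳ (anyAdjacent (sameOrder p x) (u ++ a ∷ v ++ b ∷ c ∷ t)) (Occurrence⇒contains (dash-yz u a v b c t o))
Occurrence⇒contains {p = xy-dash p} (xy-dash [] a b v c t o) =
  T-∨-introˡ (containsDashLast p (b ∷ v ++ c ∷ t)) (any⁺ (sameOrder p a b) (++⁺ʳ v (here o)))
Occurrence⇒contains {p = xy-dash p} (xy-dash (x ∷ []) a b v c t o) =
  T-∨-introʳ (any (sameOrder p x a) (b ∷ v ++ c ∷ t)) (Occurrence⇒contains (xy-dash [] a b v c t o))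
Occurrence⇒contains {p = xy-dash p} (xy-dash (x ∷ y ∷ u) a b v c t o) =
  T-∨-introʳ (any (sameOrder p x y) (u ++ a ∷ b ∷ v ++ c ∷ t)) (Occurrence⇒contains (xy-dash (y ∷ u) a b v c t o))

Occurrence-reverseComplement : ∀ {p} → All (_≤ 4) (lettersᴰ p) → All (_< n) w →
  Occurrence p w → Occurrence (reverseComplementᴰ p) (reverseComplement n w)
Occurrence-reverseComplement {n} {p = dash-yz p} p≤4 w<n (dash-yz u a v b c t o)
  with a<n ∷ vbct<n ← ++⁻ʳ u w<n with b<n ∷ c<n ∷ _ ← ++⁻ʳ v vbct<n =
  subst (Occurrence (xy-dash (reverseComplementᴾ p))) (sym split)
    (xy-dash (rc t) (n ∸ suc c) (n ∸ suc b) (rc v) (n ∸ suc a) (rc u)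
      (subst T (sym (sameOrder-reverseComplement p p≤4 (a<n ∷ b<n ∷ c<n ∷ []))) o))
  where
  open ≡-Reasoning
  rc = reverseComplement n
  split : rc (u ++ a ∷ v ++ b ∷ c ∷ t) ≡ rc t ++ n ∸ suc c ∷ n ∸ suc b ∷ rc v ++ n ∸ suc a ∷ rc u
  split = begin
    rc (u ++ a ∷ v ++ b ∷ c ∷ t)
      ≡⟨ reverseComplement-++-∷ n u a _ ⟩
    rc (v ++ b ∷ c ∷ t) ++ n ∸ suc a ∷ rc u
      ≡⟨ cong (_++ n ∸ suc a ∷ rc u) (reverseComplement-++-∷ n v b (c ∷ t)) ⟩
    (rc (c ∷ t) ++ n ∸ suc b ∷ rc v) ++ n ∸ suc a ∷ rc u
      ≡⟨ ++-assoc (rc (c ∷ t)) _ _ ⟩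
    rc ([] ++ c ∷ t) ++ n ∸ suc b ∷ rc v ++ n ∸ suc a ∷ rc u
      ≡⟨ cong (_++ n ∸ suc b ∷ rc v ++ n ∸ suc a ∷ rc u) (reverseComplement-++-∷ n [] c t) ⟩
    (rc t ++ n ∸ suc c ∷ []) ++ n ∸ suc b ∷ rc v ++ n ∸ suc a ∷ rc u
      ≡⟨ ++-assoc (rc t) _ _ ⟩
    rc t ++ n ∸ suc c ∷ n ∸ suc b ∷ rc v ++ n ∸ suc a ∷ rc u
      ∎
Occurrence-reverseComplement {n} {p = xy-dash p} p≤4 w<n (xy-dash u a b v c t o)
  with a<n ∷ b<n ∷ vct<n ← ++⁻ʳ u w<n with c<n ∷ _ ← ++⁻ʳ v vct<n =
  subst (Occurrence (dash-yz (reverseComplementᴾ p))) (sym split)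
    (dash-yz (rc t) (n ∸ suc c) (rc v) (n ∸ suc b) (n ∸ suc a) (rc u)
      (subst T (sym (sameOrder-reverseComplement p p≤4 (a<n ∷ b<n ∷ c<n ∷ []))) o))
  where
  open ≡-Reasoning
  rc = reverseComplement n
  split : rc (u ++ a ∷ b ∷ v ++ c ∷ t) ≡ rc t ++ n ∸ suc c ∷ rc v ++ n ∸ suc b ∷ n ∸ suc a ∷ rc u
  split = begin
    rc (u ++ a ∷ b ∷ v ++ c ∷ t)
      ≡⟨ reverseComplement-++-∷ n u a _ ⟩
    rc ([] ++ b ∷ v ++ c ∷ t) ++ n ∸ suc a ∷ rc u
      ≡⟨ cong (_++ n ∸ suc a ∷ rc u) (reverseComplement-++-∷ n [] b (v ++ c ∷ t)) ⟩
    (rc (v ++ c ∷ t) ++ n ∸ suc b ∷ []) ++ n ∸ suc a ∷ rc u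
      ≡⟨ ++-assoc (rc (v ++ c ∷ t)) _ _ ⟩
    rc (v ++ c ∷ t) ++ n ∸ suc b ∷ n ∸ suc a ∷ rc u
      ≡⟨ cong (_++ n ∸ suc b ∷ n ∸ suc a ∷ rc u) (reverseComplement-++-∷ n v c t) ⟩
    (rc t ++ n ∸ suc c ∷ rc v) ++ n ∸ suc b ∷ n ∸ suc a ∷ rc u
      ≡⟨ ++-assoc (rc t) _ _ ⟩
    rc t ++ n ∸ suc c ∷ rc v ++ n ∸ suc b ∷ n ∸ suc a ∷ rc u
      ∎

contains⇒contains-reverseComplement : ∀ p → All (_≤ 4) (lettersᴰ p) → All (_< n) w →
  T (contains p w) → T (contains (reverseComplementᴰ p) (reverseComplement n w))
contains⇒contains-reverseComplement {w = w} p p≤4 w<n =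
  Occurrence⇒contains ∘′ Occurrence-reverseComplement p≤4 w<n ∘′ contains⇒Occurrence p w

contains-reverseComplement : ∀ p → All (_≤ 4) (lettersᴰ p) → IsPermutation n w →
  contains (reverseComplementᴰ p) (reverseComplement n w) ≡ contains p w
contains-reverseComplement {n} p p≤4 π = T-extensional
  (subst T (cong₂ contains (reverseComplementᴰ-involutive p p≤4) (reverseComplement-involutive (bounded π)))
   ∘′ contains⇒contains-reverseComplement (reverseComplementᴰ p) (reverseComplementᴰ-≤4 p)
        (bounded (IsPermutation-reverseComplement π)))
  (contains⇒contains-reverseComplement p p≤4 (bounded π))

reverseComplement-↔ : ∀ p q → All (_≤ 4) (lettersᴰ p) → All (_≤ 4) (lettersᴰ q) →
  Avoiders n p q ↔ Avoiders n (reverseComplementᴰ p) (reverseComplementᴰ q)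
reverseComplement-↔ {n} p q p≤4 q≤4 =
  involution⇒Avoiders-↔ p q (reverseComplementᴰ p) (reverseComplementᴰ q)
    (reverseComplement n) IsPermutation-reverseComplement reverseComplement-involutive
    (contains-reverseComplement p p≤4) (contains-reverseComplement q q≤4)

-- Permutations avoiding 1-23 and 2-31

-- For distinct letters, Guard a b c says that a b c is an occurrence of neither 1-23 (a < b < c)
-- nor 2-31 (c < a < b).
Guard : ℕ → ℕ → ℕ → Set
Guard a b c = a < b → a < c × c < b

Guarded : List ℕ → Set
Guarded []      = ⊤
Guarded (a ∷ w) = Linked (Guard a) w × Guarded w

¬123∧¬231⇒Guard : b ≢ c → ¬ T (sameOrder (pat 1 2 3) a b c) → ¬ T (sameOrder (pat 2 3 1) a b c) → Guard a b c
¬123∧¬231⇒Guard {b} {c} {a} b≢c ¬123 ¬231 a<b with a <? c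
... | no a≮c = ⊥-elim (¬231 (T-∧-intro (<⇒<ᵇ a<b) (T-∧-intro (≮⇒T-not a≮c) (≮⇒T-not b≮c))))
  where
  ≮⇒T-not : ∀ {x y} → ¬ x < y → T (not (x <ᵇ y))
  ≮⇒T-not x≮y = Equivalence.from T-not⇔¬T (x≮y ∘′ <ᵇ⇒< _ _)
  b≮c : ¬ b < c
  b≮c b<c = a≮c (<-trans a<b b<c)
... | yes a<c with <-cmp c b
...   | tri< c<b _ _ = a<c , c<b
...   | tri≈ _ c≡b _ = ⊥-elim (b≢c (sym c≡b))
...   | tri> _ _ b<c = ⊥-elim (¬123 (T-∧-intro (<⇒<ᵇ a<b) (T-∧-intro (<⇒<ᵇ a<c) (<⇒<ᵇ b<c))))

Guard⇒¬123 : Guard a b c → ¬ T (sameOrder (pat 1 2 3) a b c)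
Guard⇒¬123 {a} {b} {c} guard t =
  let (a<b , t′) = Equivalence.to (T-∧ {a <ᵇ b}) t ; (_ , b<c) = Equivalence.to (T-∧ {a <ᵇ c}) t′
  in <-asym (proj₂ (guard (<ᵇ⇒< a b a<b))) (<ᵇ⇒< b c b<c)

Guard⇒¬231 : Guard a b c → ¬ T (sameOrder (pat 2 3 1) a b c)
Guard⇒¬231 {a} {b} {c} guard t =
  let (a<b , t′) = Equivalence.to (T-∧ {a <ᵇ b}) t ; (a≮c , _) = Equivalence.to (T-∧ {not (a <ᵇ c)}) t′
  in Equivalence.to T-not⇔¬T a≮c (<⇒<ᵇ (proj₁ (guard (<ᵇ⇒< a b a<b))))

¬anyAdjacent⇒Linked : ∀ f w → ¬ T (anyAdjacent f w) → Linked (λ b c → ¬ T (f b c)) w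
¬anyAdjacent⇒Linked f []          _    = []
¬anyAdjacent⇒Linked f (_ ∷ [])    _    = [-]
¬anyAdjacent⇒Linked f (b ∷ c ∷ w) ¬adj =
  let (¬fbc , ¬rest) = Equivalence.to (¬T-∨ {f b c}) ¬adj in ¬fbc ∷ ¬anyAdjacent⇒Linked f (c ∷ w) ¬rest

Linked⇒¬anyAdjacent : ∀ {f} → Linked (λ b c → ¬ T (f b c)) w → ¬ T (anyAdjacent f w)
Linked⇒¬anyAdjacent []                     = λ ()
Linked⇒¬anyAdjacent [-]                    = λ ()
Linked⇒¬anyAdjacent {b ∷ _} {f} (¬fbc ∷ l) = Equivalence.from (¬T-∨ {f b _}) (¬fbc , Linked⇒¬anyAdjacent l)

avoids⇒Guarded : Unique w → ¬ T (contains p1-23 w) → ¬ T (contains p2-31 w) → Guarded w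
avoids⇒Guarded {[]}    _       _    _    = _
avoids⇒Guarded {a ∷ w} (_ ∷ u) ¬123 ¬231 =
  let (¬adj₁ , ¬rest₁) = Equivalence.to (¬T-∨ {anyAdjacent (sameOrder (pat 1 2 3) a) w}) ¬123
      (¬adj₂ , ¬rest₂) = Equivalence.to (¬T-∨ {anyAdjacent (sameOrder (pat 2 3 1) a) w}) ¬231
  in Linked.zipWith (λ ((¬P₁ , ¬P₂) , b≢c) → ¬123∧¬231⇒Guard b≢c ¬P₁ ¬P₂)
       (Linked.zip (¬anyAdjacent⇒Linked _ w ¬adj₁ , ¬anyAdjacent⇒Linked _ w ¬adj₂) , AllPairs⇒Linked u)
     , avoids⇒Guarded u ¬rest₁ ¬rest₂

Guarded⇒avoids : Guarded w → ¬ T (contains p1-23 w) × ¬ T (contains p2-31 w)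
Guarded⇒avoids {[]}    _        = (λ ()) , (λ ())
Guarded⇒avoids {a ∷ w} (g , gs) =
  let (¬rest₁ , ¬rest₂) = Guarded⇒avoids gs
  in Equivalence.from (¬T-∨ {anyAdjacent (sameOrder (pat 1 2 3) a) w})
       (Linked⇒¬anyAdjacent (Linked.map Guard⇒¬123 g) , ¬rest₁)
   , Equivalence.from (¬T-∨ {anyAdjacent (sameOrder (pat 2 3 1) a) w})
       (Linked⇒¬anyAdjacent (Linked.map Guard⇒¬231 g) , ¬rest₂)

T-Avoider-123-231 : ∀ n w →
  T (isWordᵇ n n w ∧ permutationAvoidingᵇ p1-23 p2-31 w) ⇔ (IsPermutation n w × Guarded w)
T-Avoider-123-231 n w = mk⇔
  (λ t → let avoider π ¬123 ¬231 = Equivalence.to (T-Avoider p1-23 p2-31) t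
         in π , avoids⇒Guarded (unique π) ¬123 ¬231)
  (λ (π , g) → let (¬123 , ¬231) = Guarded⇒avoids g
              in Equivalence.from (T-Avoider p1-23 p2-31) (avoider π ¬123 ¬231))

Guard-vacuous : b < a → Guard a b c
Guard-vacuous b<a a<b = ⊥-elim (<-asym a<b b<a)

below-∷ : b < a → Linked (Guard a) w → Linked (Guard a) (b ∷ w)
below-∷ b<a []      = [-]
below-∷ b<a [-]     = Guard-vacuous b<a ∷ [-]
below-∷ b<a (g ∷ l) = Guard-vacuous b<a ∷ g ∷ l

below⇒guards : All (_< a) w → Linked (Guard a) w
below⇒guards []          = []
below⇒guards (b<a ∷ w<a) = below-∷ b<a (below⇒guards w<a)

guards-++ : All (_< a) σ → Linked (Guard a) τ → Linked (Guard a) (σ ++ τ)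
guards-++ []          l = l
guards-++ (b<a ∷ σ<a) l = below-∷ b<a (guards-++ σ<a l)

descending-above⇒guards : Linked _>_ τ → All (a <_) τ → Linked (Guard a) τ
descending-above⇒guards []        _               = []
descending-above⇒guards [-]       _               = [-]
descending-above⇒guards (c<b ∷ d) (_ ∷ a<c ∷ a<τ) = (λ _ → a<c , c<b) ∷ descending-above⇒guards d (a<c ∷ a<τ)

descending⇒Guarded : Linked _>_ w → Guarded w
descending⇒Guarded []         = _
descending⇒Guarded [-]        = [] , _
descending⇒Guarded d@(_ ∷ d′) = below⇒guards (descending⇒below d) , descending⇒Guarded d′

descending-runs⇒Guarded : ∀ {h} → Linked _>_ σ → Linked _>_ τ → All (_< h) σ → All (h ≤_) τ → Guarded (σ ++ τ)
descending-runs⇒Guarded {[]}    _  dτ _           _   = descending⇒Guarded dτ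
descending-runs⇒Guarded {_ ∷ σ} dσ dτ (s<h ∷ σ<h) h≤τ =
    guards-++ (descending⇒below dσ) (descending-above⇒guards dτ (All.map (<-≤-trans s<h) h≤τ))
  , descending-runs⇒Guarded (Linked.tail dσ) dτ σ<h h≤τ

ascent⇒descending : a < b → Linked (Guard a) (b ∷ w) → Linked _>_ (b ∷ w) × All (a <_) (b ∷ w)
ascent⇒descending a<b [-]     = [-] , a<b ∷ []
ascent⇒descending a<b (g ∷ l) =
  let (a<c , c<b) = g a<b ; (d , a<w) = ascent⇒descending a<c l in c<b ∷ d , a<b ∷ a<w

guarded-descending-above : Linked (Guard a) τ → Linked _>_ τ → Any (a <_) τ → All (a <_) τ
guarded-descending-above g _ (here a<t)  = proj₂ (ascent⇒descending a<t g)
guarded-descending-above g d (there a<τ) =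
  proj₂ (ascent⇒descending (All.lookupWith (λ x<t a<x → <-trans a<x x<t) (descending⇒below d) a<τ) g)

guarded-runs : Unique (a ∷ w) → Guarded (a ∷ w) → Any (a <_) w →
  ∃₂ λ σ τ → w ≡ σ ++ τ × Linked _>_ (a ∷ σ) × Linked _>_ τ × All (a <_) τ
guarded-runs {a} {b ∷ w} (a∉ ∷ u) (g , gs) a<w with <-cmp a b
... | tri< a<b _ _ = [] , b ∷ w , refl , [-] , ascent⇒descending a<b g
... | tri≈ _ a≡b _ = ⊥-elim (All.head a∉ a≡b)
... | tri> _ _ b<a with guarded-runs u gs (b<w a<w)
  where
  b<w : Any (a <_) (b ∷ w) → Any (b <_) w
  b<w (here a<b)  = ⊥-elim (<-asym a<b b<a)
  b<w (there a<w) = Any.map (<-trans b<a) a<w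
...   | σ , τ , refl , dσ , dτ , _ =
  b ∷ σ , τ , refl , b<a ∷ dσ , dτ , guarded-descending-above (Linked-++⁻ʳ (b ∷ σ) g) dτ (a<τ a<w)
  where
  -- the letters above a cannot lie in b ∷ σ, which is below a
  a<τ : Any (a <_) (b ∷ σ ++ τ) → Any (a <_) τ
  a<τ (here a<b)   = ⊥-elim (<-asym a<b b<a)
  a<τ (there a<στ) with ++⁻ σ a<στ
  ... | inj₁ a<σ = ⊥-elim (<-asym b<a (All.lookupWith (λ s<b a<s → <-trans a<s s<b) (descending⇒below dσ) a<σ))
  ... | inj₂ a<τ = a<τ

twoRuns : ℕ → ℕ → List ℕ
twoRuns m a = run 0 (suc a) ++ run (suc a) (m ∸ suc a)

twoRuns-IsPermutation : a < m → IsPermutation m (twoRuns m a)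
twoRuns-IsPermutation {a} {m} a<m = record
  { length≡ = begin
      length (run 0 (suc a) ++ run (suc a) (m ∸ suc a))         ≡⟨ length-++ (run 0 (suc a)) ⟩
      length (run 0 (suc a)) + length (run (suc a) (m ∸ suc a))
        ≡⟨ cong₂ _+_ (length-applyDownFrom _ (suc a)) (length-applyDownFrom _ (m ∸ suc a)) ⟩
      suc a + (m ∸ suc a)                                       ≡⟨ m+[n∸m]≡n a<m ⟩
      m                                                         ∎
  ; bounded = All-++⁺ (All.map (λ (_ , x<1+a) → <-≤-trans x<1+a a<m) (run-bounded 0 (suc a)))
                      (All.map (λ (_ , x<m) → subst (_ <_) (m+[n∸m]≡n a<m) x<m) (run-bounded (suc a) (m ∸ suc a)))
  ; unique  = Unique-++⁺ (descending⇒Unique (run-descending 0 (suc a)))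
                         (descending⇒Unique (run-descending (suc a) (m ∸ suc a)))
      (λ (x∈low , x∈high) → <⇒≱ (proj₂ (All.lookup (run-bounded 0 (suc a)) x∈low))
                                 (proj₁ (All.lookup (run-bounded (suc a) (m ∸ suc a)) x∈high)))
  }
  where open ≡-Reasoning

twoRuns-Guarded : ∀ m a → Guarded (twoRuns m a)
twoRuns-Guarded m a = descending-runs⇒Guarded (run-descending 0 (suc a)) (run-descending (suc a) (m ∸ suc a))
  (All.map proj₂ (run-bounded 0 (suc a))) (All.map proj₁ (run-bounded (suc a) (m ∸ suc a)))

twoRuns-unique : IsPermutation m (a ∷ w) → Guarded (a ∷ w) → suc a < m → a ∷ w ≡ twoRuns m a
twoRuns-unique {m} {a} {w} π g 1+a<m with unique⇒exists-above (unique π) (subst (suc a <_) (sym (length≡ π)) 1+a<m)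
... | here a<a = ⊥-elim (<-irrefl refl a<a)
... | there a<w with σ , τ , refl , dσ , dτ , a<τ ← guarded-runs (unique π) g a<w =
  cong₂ _++_ (descending-full⇒run 0 (suc a) (≤-refl ∷ dσ) 0≤ (proj₁ lengths))
             (descending-full⇒run (suc a) (m ∸ suc a) τ-below a<τ (proj₂ lengths))
  where
  m≡1+a+[m∸1+a] : m ≡ suc a + (m ∸ suc a)
  m≡1+a+[m∸1+a] = sym (m+[n∸m]≡n (<⇒≤ 1+a<m))
  0≤ : All (0 ≤_) (a ∷ σ)
  0≤ = All.tabulate (λ _ → z≤n)
  τ-below : Linked _>_ (suc a + (m ∸ suc a) ∷ τ)
  τ-below = subst (λ h → Linked _>_ (h ∷ τ)) m≡1+a+[m∸1+a] (below∷descending (++⁻ʳ (a ∷ σ) (bounded π)) dτ)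
  lengths : length (a ∷ σ) ≡ suc a × length τ ≡ m ∸ suc a
  lengths = ≤-+-≡⇒≡ (descending-length≤ 0 (suc a) (≤-refl ∷ dσ) 0≤)
                    (descending-length≤ (suc a) (m ∸ suc a) τ-below a<τ)
                    (trans (sym (length-++ (a ∷ σ))) (trans (length≡ π) m≡1+a+[m∸1+a]))

IsPermutation-∷max : IsPermutation n w → IsPermutation (suc n) (n ∷ w)
IsPermutation-∷max π = record
  { length≡ = cong suc (length≡ π)
  ; bounded = n<1+n _ ∷ All.map m<n⇒m<1+n (bounded π)
  ; unique  = All.map >⇒≢ (bounded π) ∷ unique π
  }

IsPermutation-tail : IsPermutation (suc n) (n ∷ w) → IsPermutation n w
IsPermutation-tail π with _ ∷ w<1+n ← bounded π | n∉w ∷ u ← unique π = record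
  { length≡ = suc-injective (length≡ π)
  ; bounded = All<1+n∧≢n⇒<n w<1+n n∉w
  ; unique  = u
  }

Avoiders-suc-↔ : Avoiders (suc n) p1-23 p2-31 ↔ (Avoiders n p1-23 p2-31 ⊎ Fin n)
Avoiders-suc-↔ {n} = mk↔ₛ′ to from to∘from from∘to
  where
  to : Avoiders (suc n) p1-23 p2-31 → Avoiders n p1-23 p2-31 ⊎ Fin n
  to (a ∷ w , t) with (π , g) ← Equivalence.to (T-Avoider-123-231 (suc n) (a ∷ w)) t | a ≟ n
  ... | yes refl = inj₁ (w , Equivalence.from (T-Avoider-123-231 n w) (IsPermutation-tail π , proj₂ g))
  ... | no a≢n   = inj₂ (fromℕ< (≤∧≢⇒< (≤-pred (All.head (bounded π))) a≢n))
  from : Avoiders n p1-23 p2-31 ⊎ Fin n → Avoiders (suc n) p1-23 p2-31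
  from (inj₁ (w , t)) = let (π , g) = Equivalence.to (T-Avoider-123-231 n w) t in
    n ∷ w , Equivalence.from (T-Avoider-123-231 (suc n) (n ∷ w)) (IsPermutation-∷max π , below⇒guards (bounded π) , g)
  from (inj₂ i) = twoRuns (suc n) (toℕ i) , Equivalence.from (T-Avoider-123-231 (suc n) (twoRuns (suc n) (toℕ i)))
    (twoRuns-IsPermutation (m<n⇒m<1+n (toℕ<n i)) , twoRuns-Guarded (suc n) (toℕ i))
  to∘from : ∀ x → to (from x) ≡ x
  to∘from (inj₁ (w , t)) with n ≟ n
  ... | yes refl = cong inj₁ (Σ-T-≡ refl)
  ... | no  n≢n  = ⊥-elim (n≢n refl)
  to∘from (inj₂ i) with toℕ i ≟ n
  ... | yes i≡n = ⊥-elim (<-irrefl i≡n (toℕ<n i))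
  ... | no  _   = cong inj₂ (fromℕ<-toℕ i _)
  from∘to : ∀ x → from (to x) ≡ x
  from∘to (a ∷ w , t) with (π , g) ← Equivalence.to (T-Avoider-123-231 (suc n) (a ∷ w)) t | a ≟ n
  ... | yes refl = Σ-T-≡ refl
  ... | no a≢n   = Σ-T-≡ (trans (cong (twoRuns (suc n)) (toℕ-fromℕ< _)) (sym (twoRuns-unique π g (s≤s a<n))))
    where a<n = ≤∧≢⇒< (≤-pred (All.head (bounded π))) a≢n

binomial-step : ∀ n → suc n C 2 + 1 ≡ (n C 2 + 1) + n
binomial-step n = begin
  suc n C 2 + 1          ≡⟨ cong (_+ 1) (nCk+nC[k+1]≡[n+1]C[k+1] n 1) ⟨
  (n C 1 + n C 2) + 1    ≡⟨ cong (λ k → k + n C 2 + 1) (nC1≡n n) ⟩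
  (n + n C 2) + 1        ≡⟨ cong (_+ 1) (+-comm n (n C 2)) ⟩
  (n C 2 + n) + 1        ≡⟨ +-assoc (n C 2) n 1 ⟩
  n C 2 + (n + 1)        ≡⟨ cong (n C 2 +_) (+-comm n 1) ⟩
  n C 2 + (1 + n)        ≡⟨ +-assoc (n C 2) 1 n ⟨
  (n C 2 + 1) + n        ∎
  where open ≡-Reasoning

Avoiders-count : ∀ n → Fin (n C 2 + 1) ↔ Avoiders n p1-23 p2-31
Avoiders-count zero = mk↔ₛ′ (λ _ → [] , _) (λ _ → zero) to∘from (λ { zero → refl })
  where
  to∘from : (x : Avoiders 0 p1-23 p2-31) → ([] , _) ≡ x
  to∘from ([] , _) = refl
Avoiders-count (suc n) = subst (λ k → Fin k ↔ Avoiders (suc n) p1-23 p2-31) (sym (binomial-step n))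
  (↔-trans +↔⊎ (↔-trans (Avoiders-count n ⊎-↔ ↔-refl) (↔-sym Avoiders-suc-↔)))

mainTheorem3 : (n : ℕ) →
    (Fin (n C 2 + 1) ↔ S n p1-23 p2-31) × (Fin (n C 2 + 1) ↔ S n p3-21 p2-13) ×
    (Fin (n C 2 + 1) ↔ S n p12-3 p31-2) × (Fin (n C 2 + 1) ↔ S n p32-1 p13-2)
mainTheorem3 n =
    ↔-trans count (↔-sym (S↔Avoiders p1-23 p2-31))
  , ↔-trans count (↔-trans by-complement (↔-sym (S↔Avoiders p3-21 p2-13)))
  , ↔-trans count (↔-trans (reverseComplement-↔ p1-23 p2-31 (≤4 p1-23) (≤4 p2-31))
                           (↔-sym (S↔Avoiders p12-3 p31-2)))
  , ↔-trans count (↔-trans by-complement (↔-trans (reverseComplement-↔ p3-21 p2-13 (≤4 p3-21) (≤4 p2-13))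
                                                  (↔-sym (S↔Avoiders p32-1 p13-2))))
  where
  ≤4 : ∀ p → From-yes (All.all? (_≤? 4) (lettersᴰ p))
  ≤4 p = from-yes (All.all? (_≤? 4) (lettersᴰ p))
  letters-unique : ∀ p → From-yes (unique? (lettersᴰ p))
  letters-unique p = from-yes (unique? (lettersᴰ p))
  count : Fin (n C 2 + 1) ↔ Avoiders n p1-23 p2-31
  count = Avoiders-count n
  by-complement : Avoiders n p1-23 p2-31 ↔ Avoiders n p3-21 p2-13
  by-complement = complement-↔ (pat 1 2 3) (pat 2 3 1)
    (letters-unique p1-23) (≤4 p1-23) (letters-unique p2-31) (≤4 p2-31)
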